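{- Let $G=(V,E)$ be a directed graph on $n$ vertices whose underlying undirected graph has diameter $1$. For every two vertices $x,y\in V$ and every index $i\in\{0,\dots,n-1\}$, if $f_i[x]\ne\perp$ and $f_i[x]\ge d_{out}(y)$, then $G$ contains a directed path from $x$ to $y$ of length at most $3(i+1)$.
   Context: Directed graphs are simple (anti-parallel edges allowed); underlying diameter $1$ means between every two distinct vertices at least one directed edge is present. $N_{out}(x)$ is the set of out-neighbours of $x$, $d_{out}$ the out-degree. For each integer $0\le i<n$, let $A(i)=\{u\in V: d_{out}(u)>i \text{ and there is } w\in V \text{ with } (w,u)\in E \text{ and } d_{out}(w)\le i\}$, and let $M(i)=\perp$ if $A(i)=\varnothing$ and $M(i)=\max\{d_{out}(v): v\in A(i)\}$ otherwise. For each $x\in V$ define $f_0[x]=\max\{d_{out}(v): v\in\{x\}\cup N_{out}(x)\}$, and for $k\in\{1,\dots,n\}$ let $f_k[x]=\perp$ if $f_{k-1}[x]=\perp$ and $f_k[x]=M(f_{k-1}[x])$ otherwise. -}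

module Defs where

open import Data.Nat using (ℕ; zero; suc; _⊔_; _<ᵇ_; _≤ᵇ_)
open import Data.Bool using (Bool; true; false; _∧_)
open import Data.Fin using (Fin; suc; inject₁; fromℕ)
open import Data.List using (List; []; _∷_; filterᵇ; length; foldr; map)
open import Data.Bool.ListAction using (any)
open import Data.List.Base using (allFin)
open import Data.Maybe using (Maybe; just; nothing; maybe′; _>>=_)
open import Data.Vec using (Vec; lookup)
open import Data.Sum using (_⊎_)
open import Relation.Binary.PropositionalEquality using (_≡_; _≢_)
open import Function.Definitions using (Injective)

-- A simple directed graph on vertex set Fin n: Boolean adjacency, no loops.
-- Anti-parallel edges (adj x y and adj y x) are allowed.
record Digraph (n : ℕ) : Set where
  field
    adj   : Fin n → Fin n → Bool
    loopless : ∀ x → adj x x ≡ false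
open Digraph public

-- underlying undirected graph has diameter 1: any two distinct vertices
-- are joined by at least one directed edge
UnderlyingDiam1 : ∀ {n} → Digraph n → Set
UnderlyingDiam1 {n} G = ∀ (x y : Fin n) → x ≢ y → adj G x y ≡ true ⊎ adj G y x ≡ true

Nout : ∀ {n} → Digraph n → Fin n → List (Fin n)
Nout {n} G x = filterᵇ (adj G x) (allFin n)

dout : ∀ {n} → Digraph n → Fin n → ℕ
dout G x = length (Nout G x)

maxM : List ℕ → Maybe ℕ
maxM = foldr (λ a r → just (maybe′ (a ⊔_) a r)) nothing

A : ∀ {n} → Digraph n → ℕ → List (Fin n)
A {n} G i = filterᵇ
  (λ u → (i <ᵇ dout G u) ∧ any (λ w → adj G w u ∧ (dout G w ≤ᵇ i)) (allFin n))
  (allFin n)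

M : ∀ {n} → Digraph n → ℕ → Maybe ℕ
M G i = maxM (map (dout G) (A G i))

f0 : ∀ {n} → Digraph n → Fin n → ℕ
f0 G x = foldr _⊔_ (dout G x) (map (dout G) (Nout G x))

-- f_k[x]; ⊥ is nothing, and f_k = M(f_{k-1}) when f_{k-1} ≠ ⊥
f : ∀ {n} → Digraph n → ℕ → Fin n → Maybe ℕ
f G zero x = just (f0 G x)
f G (suc k) x = f G k x >>= M G

record Path {n} (G : Digraph n) (x y : Fin n) : Set where
  field
    len   : ℕ
    verts : Vec (Fin n) (suc len)
    start : lookup verts Fin.zero ≡ x
    end   : lookup verts (fromℕ len) ≡ y
    steps : ∀ (j : Fin len) → adj G (lookup verts (inject₁ j)) (lookup verts (suc j)) ≡ true
    distinct : Injective _≡_ _≡_ (lookup verts)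
open Path public

module Submission where

-- Call a vertex "rich" relative to y when its out-degree
-- is at least d_out(y).  The key observation (short-reach) is that in a digraph
-- whose underlying graph is complete, every rich vertex z reaches y within two
-- steps: either z → y, or y → z, and then N_out(z) ⊄ N_out(y) because
-- z ∈ N_out(y) \ N_out(z) while |N_out(z)| ≥ |N_out(y)|; an out-neighbour w of z
-- outside N_out(y) satisfies w → y by completeness, giving z → w → y.
-- The value f_i[x] is realised as the out-degree of a concrete vertex:
-- f_0[x] by x or one of its out-neighbours (one step from x), and
-- f_{k+1}[x] = M(f_k[x]) by a vertex u with an in-neighbour w of out-degree
-- at most f_k[x].  Induction on i then yields a walk x ⇝ w of length ≤ 3(k+1)
-- (induction hypothesis), the edge w → u, and u ⇝ y of length ≤ 2 (short-reach).
-- Finally every walk shortens to a path with pairwise distinct vertices.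

open import Defs
open import Data.Nat using (ℕ; zero; suc; _<_; _≤_; _*_; _+_; _⊔_; z≤n; s≤s)
open import Data.Nat.Properties
  using (≤-refl; ≤-trans; ≤-reflexive; m≤n⇒m≤1+n; <⇒≱; +-mono-≤; +-comm; *-suc; ⊔-sel; ≤ᵇ⇒≤)
open import Data.Fin using (Fin; inject₁; fromℕ; _≟_) renaming (zero to fzero; suc to fsuc)
open import Data.Maybe using (just; nothing)
open import Data.Product using (Σ; _,_; _×_; proj₂)
open import Data.Sum using (_⊎_; inj₁; inj₂; map₂)
open import Data.Bool using (Bool; true; false; T; T?)
open import Data.Bool.Properties using (T-≡; T-∧)
open import Data.Empty using (⊥; ⊥-elim)
open import Data.Unit using (⊤; tt)
open import Data.List using (List; []; _∷_; filterᵇ; length; foldr; map; allFin)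
open import Data.List.Relation.Unary.Any using (here; there; satisfied)
open import Data.List.Relation.Unary.Any.Properties using (any⁻)
open import Data.List.Membership.Propositional using (_∈_)
open import Data.List.Membership.Propositional.Properties using (∈-allFin; ∈-filter⁻)
open import Data.Vec using (Vec; lookup) renaming (_∷_ to _∷ᵛ_; [] to []ᵛ)
import Data.Vec.Relation.Unary.Any as VecAny
open import Data.Vec.Membership.Propositional.Properties using (∈-lookup)
open import Function using (_∘_)
open import Function.Bundles using (Equivalence)
open import Relation.Nullary using (yes; no)
open import Relation.Binary.PropositionalEquality using (_≡_; refl; sym; trans; cong; subst)

filterᵇ-sound : ∀ {A : Set} (p : A → Bool) xs {z} → z ∈ filterᵇ p xs → T (p z)
filterᵇ-sound p xs mem = proj₂ (∈-filter⁻ (T? ∘ p) {xs = xs} mem)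

T⇒≡true : ∀ {b} → T b → b ≡ true
T⇒≡true = Equivalence.to T-≡

true-and-false : ∀ {b} → b ≡ true → b ≡ false → ⊥
true-and-false refl ()

module Counting {A : Set} where

  count : (A → Bool) → List A → ℕ
  count p xs = length (filterᵇ p xs)

  NotContained : (A → Bool) → (A → Bool) → Set
  NotContained p q = Σ A (λ a → p a ≡ true × q a ≡ false)

  count-mono : ∀ p q xs → NotContained p q ⊎ count p xs ≤ count q xs
  count-mono p q [] = inj₂ z≤n
  count-mono p q (a ∷ xs) with p a in pa | q a in qa
  ... | true  | false = inj₁ (a , pa , qa)
  ... | true  | true  = map₂ s≤s (count-mono p q xs)
  ... | false | true  = map₂ m≤n⇒m≤1+n (count-mono p q xs)
  ... | false | false = count-mono p q xs

  count-mono-strict : ∀ p q xs {z} → z ∈ xs → p z ≡ false → q z ≡ true →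
                      NotContained p q ⊎ count p xs < count q xs
  count-mono-strict p q (a ∷ xs) (here refl) pz qz rewrite pz | qz =
    map₂ s≤s (count-mono p q xs)
  count-mono-strict p q (a ∷ xs) (there mem) pz qz with p a in pa | q a in qa
  ... | true  | false = inj₁ (a , pa , qa)
  ... | true  | true  = map₂ s≤s (count-mono-strict p q xs mem pz qz)
  ... | false | true  = map₂ m≤n⇒m≤1+n (count-mono-strict p q xs mem pz qz)
  ... | false | false = count-mono-strict p q xs mem pz qz

  maxM-attained : ∀ (g : A → ℕ) xs {m} → maxM (map g xs) ≡ just m →
                  Σ A (λ u → u ∈ xs × g u ≡ m)
  maxM-attained g (a ∷ xs) eq with maxM (map g xs) in rest
  maxM-attained g (a ∷ xs) refl | nothing = a , here refl , refl
  maxM-attained g (a ∷ xs) refl | just r with ⊔-sel (g a) r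
  ... | inj₁ left = a , here refl , sym left
  ... | inj₂ right with maxM-attained g xs rest
  ... | u , mem , gu = u , there mem , trans gu (sym right)

  foldr-⊔-attained : ∀ (g : A → ℕ) a xs →
    (foldr _⊔_ a (map g xs) ≡ a) ⊎ Σ A (λ u → u ∈ xs × g u ≡ foldr _⊔_ a (map g xs))
  foldr-⊔-attained g a [] = inj₁ refl
  foldr-⊔-attained g a (b ∷ xs) with ⊔-sel (g b) (foldr _⊔_ a (map g xs))
  ... | inj₁ left = inj₂ (b , here refl , sym left)
  ... | inj₂ right with foldr-⊔-attained g a xs
  ... | inj₁ seed = inj₁ (trans right seed)
  ... | inj₂ (u , mem , gu) = inj₂ (u , there mem , trans gu (sym right))

open Counting

module Walks {n : ℕ} (G : Digraph n) where

  open import Data.Vec.Membership.DecPropositional (_≟_ {n})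
    using (_∈?_) renaming (_∈_ to _∈ᵛ_; _∉_ to _∉ᵛ_)

  _⟶_ : Fin n → Fin n → Set
  x ⟶ y = adj G x y ≡ true

  infixr 5 _▹_
  data Walk : Fin n → Fin n → Set where
    stay : ∀ {x} → Walk x x
    _▹_  : ∀ {x y z} → x ⟶ y → Walk y z → Walk x z

  wlength : ∀ {x y} → Walk x y → ℕ
  wlength stay    = 0
  wlength (_ ▹ w) = suc (wlength w)

  _++ʷ_ : ∀ {x y z} → Walk x y → Walk y z → Walk x z
  stay    ++ʷ v = v
  (e ▹ w) ++ʷ v = e ▹ (w ++ʷ v)

  length-++ʷ : ∀ {x y z} (w : Walk x y) (v : Walk y z) →
               wlength (w ++ʷ v) ≡ wlength w + wlength v
  length-++ʷ stay    v = refl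
  length-++ʷ (e ▹ w) v = cong suc (length-++ʷ w v)

  WalkWithin : Fin n → Fin n → ℕ → Set
  WalkWithin x y k = Σ (Walk x y) (λ w → wlength w ≤ k)

  edge : ∀ {x y} → x ⟶ y → WalkWithin x y 1
  edge e = e ▹ stay , s≤s z≤n

  infixr 5 _⨾_
  _⨾_ : ∀ {x y z a b} → WalkWithin x y a → WalkWithin y z b → WalkWithin x z (a + b)
  (w , w≤a) ⨾ (v , v≤b) = w ++ʷ v , ≤-trans (≤-reflexive (length-++ʷ w v)) (+-mono-≤ w≤a v≤b)

  weaken : ∀ {x y k k′} → k ≤ k′ → WalkWithin x y k → WalkWithin x y k′
  weaken k≤k′ (w , w≤k) = w , ≤-trans w≤k k≤k′

  vertices : ∀ {x y} (w : Walk x y) → Vec (Fin n) (suc (wlength w))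
  vertices {x} stay    = x ∷ᵛ []ᵛ
  vertices {x} (_ ▹ w) = x ∷ᵛ vertices w

  Simple : ∀ {x y} → Walk x y → Set
  Simple stay        = ⊤
  Simple {x} (_ ▹ w) = x ∉ᵛ vertices w × Simple w

  SimpleWithin : Fin n → Fin n → ℕ → Set
  SimpleWithin x y k = Σ (Walk x y) (λ w → Simple w × wlength w ≤ k)

  suffix : ∀ {z y v} (w : Walk z y) → Simple w → v ∈ᵛ vertices w → SimpleWithin v y (wlength w)
  suffix stay    _             (VecAny.here refl) = stay , tt , z≤n
  suffix (e ▹ w) simple        (VecAny.here refl) = e ▹ w , simple , ≤-refl
  suffix (e ▹ w) (_ , simple) (VecAny.there mem) with suffix w simple mem
  ... | v , simple-v , v≤w = v , simple-v , m≤n⇒m≤1+n v≤w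

  -- Every walk shortens to a simple walk: cut out each closed detour.
  simplify : ∀ {x y} (w : Walk x y) → SimpleWithin x y (wlength w)
  simplify stay = stay , tt , z≤n
  simplify {x} (e ▹ w) with simplify w
  ... | v , simple-v , v≤w with x ∈? vertices v
  ... | yes mem = let (u , simple-u , u≤v) = suffix v simple-v mem
                  in u , simple-u , m≤n⇒m≤1+n (≤-trans u≤v v≤w)
  ... | no  x∉v = e ▹ v , (x∉v , simple-v) , s≤s v≤w

  first-vertex : ∀ {x y} (w : Walk x y) → lookup (vertices w) fzero ≡ x
  first-vertex stay    = refl
  first-vertex (_ ▹ _) = refl

  last-vertex : ∀ {x y} (w : Walk x y) → lookup (vertices w) (fromℕ (wlength w)) ≡ y
  last-vertex stay    = refl
  last-vertex (_ ▹ w) = last-vertex w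

  consecutive-edges : ∀ {x y} (w : Walk x y) (j : Fin (wlength w)) →
    lookup (vertices w) (inject₁ j) ⟶ lookup (vertices w) (fsuc j)
  consecutive-edges (e ▹ w) fzero    = subst (λ t → _ ⟶ t) (sym (first-vertex w)) e
  consecutive-edges (_ ▹ w) (fsuc j) = consecutive-edges w j

  simple-distinct : ∀ {x y} (w : Walk x y) → Simple w →
    ∀ i j → lookup (vertices w) i ≡ lookup (vertices w) j → i ≡ j
  simple-distinct stay    _            fzero    fzero    _  = refl
  simple-distinct (_ ▹ w) _            fzero    fzero    _  = refl
  simple-distinct (_ ▹ w) (x∉w , _)    fzero    (fsuc j) eq =
    ⊥-elim (x∉w (subst (_∈ᵛ vertices w) (sym eq) (∈-lookup j (vertices w))))
  simple-distinct (_ ▹ w) (x∉w , _)    (fsuc i) fzero    eq =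
    ⊥-elim (x∉w (subst (_∈ᵛ vertices w) eq (∈-lookup i (vertices w))))
  simple-distinct (_ ▹ w) (_ , simple) (fsuc i) (fsuc j) eq =
    cong fsuc (simple-distinct w simple i j eq)

  walk→path : ∀ {x y k} → WalkWithin x y k → Σ (Path G x y) (λ p → len p ≤ k)
  walk→path (w , w≤k) with simplify w
  ... | v , simple-v , v≤w =
    record { len      = wlength v
           ; verts    = vertices v
           ; start    = first-vertex v
           ; end      = last-vertex v
           ; steps    = consecutive-edges v
           ; distinct = λ {i} {j} → simple-distinct v simple-v i j
           }
    , ≤-trans v≤w w≤k

module Reach {n : ℕ} (G : Digraph n) (complete : UnderlyingDiam1 G) where

  open Walks G

  -- If y → z although d_out(y) ≤ d_out(z), then N_out(z) ⊄ N_out(y):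
  -- otherwise z ∈ N_out(y) \ N_out(z) would force d_out(z) < d_out(y).
  escape : ∀ {y z} → y ⟶ z → dout G y ≤ dout G z → NotContained (adj G z) (adj G y)
  escape {y} {z} y⟶z dy≤dz
    with count-mono-strict (adj G z) (adj G y) (allFin n) (∈-allFin z) (loopless G z) y⟶z
  ... | inj₁ witness = witness
  ... | inj₂ dz<dy   = ⊥-elim (<⇒≱ dz<dy dy≤dz)

  short-reach : ∀ z y → dout G y ≤ dout G z → WalkWithin z y 2
  short-reach z y dy≤dz with z ≟ y
  ... | yes refl = stay , z≤n
  ... | no  z≢y with adj G z y in z→y
  ... | true = weaken (s≤s z≤n) (edge z→y)
  ... | false with complete z y z≢y
  ... | inj₁ z⟶y = ⊥-elim (true-and-false z⟶y z→y)
  ... | inj₂ y⟶z with escape y⟶z dy≤dz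
  ... | w , z⟶w , y↛w with w ≟ y
  ... | yes refl = ⊥-elim (true-and-false z⟶w z→y)
  ... | no  w≢y with complete w y w≢y
  ... | inj₁ w⟶y = edge z⟶w ⨾ edge w⟶y
  ... | inj₂ y⟶w = ⊥-elim (true-and-false y⟶w y↛w)

  f0-attained : ∀ x → Σ (Fin n) (λ v → WalkWithin x v 1 × dout G v ≡ f0 G x)
  f0-attained x with foldr-⊔-attained (dout G) (dout G x) (Nout G x)
  ... | inj₁ seed = x , (stay , z≤n) , sym seed
  ... | inj₂ (u , u∈N , du) =
    u , edge (T⇒≡true (filterᵇ-sound (adj G x) (allFin n) u∈N)) , du

  M-attained : ∀ {j m} → M G j ≡ just m →
    Σ (Fin n) (λ w → Σ (Fin n) (λ u → dout G w ≤ j × w ⟶ u × dout G u ≡ m))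
  M-attained {j} eq with maxM-attained (dout G) (A G j) eq
  ... | u , u∈A , du with Equivalence.to T-∧ (filterᵇ-sound _ (allFin n) u∈A)
  ... | _ , has-small-in-neighbour
    with satisfied (any⁻ _ (allFin n) has-small-in-neighbour)
  ... | w , w→u∧small with Equivalence.to T-∧ w→u∧small
  ... | w⟶u , dw≤j = w , u , ≤ᵇ⇒≤ (dout G w) j dw≤j , T⇒≡true w⟶u , du

  reach : ∀ i x {m} → f G i x ≡ just m → ∀ y → dout G y ≤ m → WalkWithin x y (3 * suc i)
  reach zero x refl y dy≤f0 with f0-attained x
  ... | v , x⇝v , dv = x⇝v ⨾ short-reach v y (subst (dout G y ≤_) (sym dv) dy≤f0)
  reach (suc k) x eq y dy≤m with f G k x in fk
  ... | just j with M-attained eq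
  ... | w , u , dw≤j , w⟶u , du =
    weaken (≤-reflexive three-more)
      (reach k x fk w dw≤j ⨾ edge w⟶u ⨾ short-reach u y (subst (dout G y ≤_) (sym du) dy≤m))
    where
    three-more : 3 * suc k + 3 ≡ 3 * suc (suc k)
    three-more = trans (+-comm (3 * suc k) 3) (sym (*-suc 3 (suc k)))

lemma6 : ∀ (n : ℕ) (G : Digraph n) → UnderlyingDiam1 G →
    ∀ (x y : Fin n) (i : ℕ) → i < n →
    ∀ (m : ℕ) → f G i x ≡ just m → dout G y ≤ m →
    Σ (Path G x y) (λ p → len p ≤ 3 * suc i)
lemma6 n G complete x y i _ m fi≡m dy≤m =
  Walks.walk→path G (Reach.reach G complete i x fi≡m y dy≤m)
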